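{- For every $k\ge1$, the subset $\mathbb Z$ is definable in the ring of Laurent polynomials $\mathbb Z[x_1,x_1^{ -1},\ldots,x_k,x_k^{ -1}]$. -}

module Defs where

open import Data.Nat using (ℕ; zero; suc)
open import Data.Integer using (ℤ; 0ℤ; 1ℤ) renaming (_+_ to _+ℤ_; _*_ to _*ℤ_; -_ to -ℤ_; _≟_ to _≟ℤ_)
open import Data.Vec using (Vec; replicate; zipWith)
open import Data.Vec.Properties using (≡-dec)
open import Data.List using (List; []; _∷_; _++_; map; concatMap)
open import Data.Product using (_×_; _,_; Σ; ∃)
open import Data.Sum using (_⊎_)
open import Data.Empty using (⊥)
open import Relation.Nullary using (¬_; yes; no)
open import Relation.Binary.PropositionalEquality using (_≡_)

-- A Laurent polynomial is represented by a finite list of terms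
-- c · x^e (c ∈ ℤ, e ∈ ℤ^k); two representations denote the same
-- Laurent polynomial iff all their coefficients agree (_≈L_).

Mono : ℕ → Set
Mono k = ℤ × Vec ℤ k

Laurent : ℕ → Set
Laurent k = List (Mono k)

coeff : ∀ {k} → Laurent k → Vec ℤ k → ℤ
coeff [] e = 0ℤ
coeff ((c , d) ∷ p) e with ≡-dec _≟ℤ_ d e
... | yes _ = c +ℤ coeff p e
... | no  _ = coeff p e

_≈L_ : ∀ {k} → Laurent k → Laurent k → Set
p ≈L q = ∀ e → coeff p e ≡ coeff q e

zeroL : ∀ {k} → Laurent k
zeroL = []

constL : ∀ {k} → ℤ → Laurent k
constL {k} c = (c , replicate k 0ℤ) ∷ []

oneL : ∀ {k} → Laurent k
oneL = constL 1ℤ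

addL : ∀ {k} → Laurent k → Laurent k → Laurent k
addL p q = p ++ q

negL : ∀ {k} → Laurent k → Laurent k
negL = map (λ { (c , d) → (-ℤ c , d) })

mulL : ∀ {k} → Laurent k → Laurent k → Laurent k
mulL p q = concatMap (λ { (c , d) → map (λ { (c' , d') → (c *ℤ c' , zipWith _+ℤ_ d d') }) q }) p

IsInteger : ∀ {k} → Laurent k → Set
IsInteger p = ∃ λ (c : ℤ) → p ≈L constL c

-- First-order logic in the language of rings (0, 1, +, -, ·, =),
-- variables as de Bruijn indices (ℕ).

data Term : Set where
  var  : ℕ → Term
  zer  : Term
  one  : Term
  _⊕_  : Term → Term → Term
  _⊗_  : Term → Term → Term
  ⊝_   : Term → Term

data Formula : Set where
  _≐_  : Term → Term → Formula
  ⊤f   : Formula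
  ⊥f   : Formula
  ¬f_  : Formula → Formula
  _∧f_ : Formula → Formula → Formula
  _∨f_ : Formula → Formula → Formula
  _⇒f_ : Formula → Formula → Formula
  ∀f   : Formula → Formula
  ∃f   : Formula → Formula

Env : ℕ → Set
Env k = ℕ → Laurent k

_∷ₑ_ : ∀ {k} → Laurent k → Env k → Env k
(a ∷ₑ ρ) zero    = a
(a ∷ₑ ρ) (suc n) = ρ n

⟦_⟧t : ∀ {k} → Term → Env k → Laurent k
⟦ var n ⟧t ρ = ρ n
⟦ zer ⟧t ρ = zeroL
⟦ one ⟧t ρ = oneL
⟦ s ⊕ t ⟧t ρ = addL (⟦ s ⟧t ρ) (⟦ t ⟧t ρ)
⟦ s ⊗ t ⟧t ρ = mulL (⟦ s ⟧t ρ) (⟦ t ⟧t ρ)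
⟦ ⊝ t ⟧t ρ = negL (⟦ t ⟧t ρ)

Sat : ∀ {k} → Formula → Env k → Set
Sat (s ≐ t) ρ = ⟦ s ⟧t ρ ≈L ⟦ t ⟧t ρ
Sat ⊤f ρ = Data.Unit.⊤ where import Data.Unit
Sat ⊥f ρ = ⊥
Sat (¬f φ) ρ = ¬ Sat φ ρ
Sat (φ ∧f ψ) ρ = Sat φ ρ × Sat ψ ρ
Sat (φ ∨f ψ) ρ = Sat φ ρ ⊎ Sat ψ ρ
Sat (φ ⇒f ψ) ρ = Sat φ ρ → Sat ψ ρ
Sat {k} (∀f φ) ρ = (a : Laurent k) → Sat φ (a ∷ₑ ρ)
Sat {k} (∃f φ) ρ = Σ (Laurent k) λ a → Sat φ (a ∷ₑ ρ)

Definable : (k : ℕ) → (Laurent k → Set) → Set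
Definable k S = Σ Formula λ φ → Σ (Env k) λ ρ →
  ∀ (a : Laurent k) → (S a → Sat φ (a ∷ₑ ρ)) × (Sat φ (a ∷ₑ ρ) → S a)

{-# OPTIONS --safe #-}

-- Modulo w - 1 we have w ≡ 1, so (w^n - 1)/(w - 1) = 1 + w + … + w^(n-1) ≡ n. Hence every natural
-- number a is a geometric residue: for every unit w there are a unit u (namely w^a) and some g
-- with u - 1 = (w - 1) g and g ≡ a modulo w - 1.
--
-- Conversely, let a geometric residue a have a nonzero coefficient at an exponent r ≠ 0. Take
-- w = x₁^M with M larger than twice every |first exponent| occurring in a. Units are monomials
-- σ x^T: the lexicographically largest exponents of u and u⁻¹ add up to 0, and so do the smallest.
-- The indicator χ of the class of r modulo M e₁, extended linearly, vanishes on the ideal (w - 1),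
-- while χ·x₁ sends (w - 1) X to M χ(X). Applied to u - 1 = (w - 1) g, χ gives χ(T) = 0 (as r ≠ 0)
-- and then χ·x₁ gives χ(g) = 0; finally χ(a) = χ(g) = 0, although by the choice of M, χ(a) is the
-- coefficient of a at r. So the integers are the a for which a or -a is a geometric residue.

module Submission where

open import Defs

open import Level using (0ℓ; _⊔_)
open import Algebra using (CommutativeRing; Semiring)
import Algebra.Consequences.Setoid as AlgebraConsequences
import Algebra.Definitions.RawSemiring as RawSemiringDefinitions
import Algebra.Properties.CommutativeSemigroup as CommutativeSemigroupProperties
import Algebra.Properties.Ring as RingProperties
open import Data.Empty using (⊥-elim)
import Data.Integer as ℤ
open import Data.Integer.Divisibility.Signed
  using (_∣_; divides; _∣?_; ∣⇒∣ᵤ; ∣-refl; ∣m+n∣m⇒∣n; ∣m∣n⇒∣m+n)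
import Data.Integer.Properties as ℤ
open import Data.Integer.Tactic.RingSolver using (solve-∀)
open import Data.List using (List; []; _∷_; _++_; map; filter)
import Data.List.Extrema as Extrema
import Data.List.Extrema.Nat as ℕExtrema
open import Data.List.Membership.Propositional using (_∈_; lose)
open import Data.List.Membership.Propositional.Properties using (∈-filter⁺; ∈-map⁺)
import Data.List.Properties as List
import Data.List.Relation.Unary.All as All
open import Data.List.Relation.Unary.All.Properties using (all-filter)
open import Data.List.Relation.Unary.Any using (here; there; any?; satisfied)
open import Data.Nat as ℕ using (ℕ; zero; suc)
import Data.Nat.Divisibility as ℕ
import Data.Nat.Properties as ℕ
open import Data.Product using (_,_; ∃; proj₁; proj₂)
open import Data.Sum using (inj₁; inj₂; [_,_]′)
open import Data.Vec as Vec using (Vec; []; _∷_; replicate; zipWith)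
import Data.Vec.Properties as Vec
import Data.Vec.Relation.Binary.Lex.Strict as Lex
open import Data.Vec.Relation.Binary.Pointwise.Inductive using (Pointwise-≡⇒≡)
open import Function using (flip; _⇔_; mk⇔; Equivalence)
open import Relation.Binary using (Rel; Antisymmetric; IsEquivalence; Setoid; TotalOrder)
import Relation.Binary.Reasoning.Setoid as SetoidReasoning
open import Relation.Nullary using (¬_; Dec; yes; no; ¬?)
open import Relation.Nullary.Decidable using (decidable-stable; _×-dec_)

module GeometricSeries {c ℓ} (R : CommutativeRing c ℓ) where

  open CommutativeRing R
  open RawSemiringDefinitions (Semiring.rawSemiring semiring) using (_^_; _×_)
  open RingProperties ring using (//-rightDividesˡ)
  open CommutativeSemigroupProperties *-commutativeSemigroup using (interchange; x∙yz≈y∙xz)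
  open SetoidReasoning setoid

  geometric : Carrier → ℕ → Carrier
  geometric w zero    = 0#
  geometric w (suc n) = w * geometric w n + 1#

  geometricSums : Carrier → ℕ → Carrier
  geometricSums w zero    = 0#
  geometricSums w (suc n) = geometric w n + geometricSums w n

  ^≈[w-1]*geometric+1 : ∀ w n → w ^ n ≈ (w - 1#) * geometric w n + 1#
  ^≈[w-1]*geometric+1 w zero = begin
    1#                  ≈⟨ +-identityˡ 1# ⟨
    0# + 1#             ≈⟨ +-congʳ (zeroʳ (w - 1#)) ⟨
    (w - 1#) * 0# + 1#  ∎
  ^≈[w-1]*geometric+1 w (suc n) = begin
    w * w ^ n                                   ≈⟨ *-congˡ (^≈[w-1]*geometric+1 w n) ⟩
    w * ((w - 1#) * g + 1#)                     ≈⟨ distribˡ w _ 1# ⟩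
    w * ((w - 1#) * g) + w * 1#                 ≈⟨ +-cong (x∙yz≈y∙xz w (w - 1#) g) (*-identityʳ w) ⟩
    (w - 1#) * (w * g) + w                      ≈⟨ +-congˡ (//-rightDividesˡ 1# w) ⟨
    (w - 1#) * (w * g) + ((w - 1#) + 1#)        ≈⟨ +-assoc _ _ 1# ⟨
    ((w - 1#) * (w * g) + (w - 1#)) + 1#        ≈⟨ +-congʳ (+-congˡ (*-identityʳ (w - 1#))) ⟨
    ((w - 1#) * (w * g) + (w - 1#) * 1#) + 1#   ≈⟨ +-congʳ (distribˡ (w - 1#) (w * g) 1#) ⟨
    (w - 1#) * (w * g + 1#) + 1#                ∎
    where g = geometric w n

  geometric≈[w-1]*geometricSums+n : ∀ w n → geometric w n ≈ (w - 1#) * geometricSums w n + n × 1#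
  geometric≈[w-1]*geometricSums+n w zero = begin
    0#                  ≈⟨ +-identityʳ 0# ⟨
    0# + 0#             ≈⟨ +-congʳ (zeroʳ (w - 1#)) ⟨
    (w - 1#) * 0# + 0#  ∎
  geometric≈[w-1]*geometricSums+n w (suc n) = begin
    w * g + 1#                                   ≈⟨ +-congʳ (*-congʳ (//-rightDividesˡ 1# w)) ⟨
    ((w - 1#) + 1#) * g + 1#                     ≈⟨ +-congʳ (distribʳ g (w - 1#) 1#) ⟩
    ((w - 1#) * g + 1# * g) + 1#                 ≈⟨ +-congʳ (+-congˡ (*-identityˡ g)) ⟩
    ((w - 1#) * g + g) + 1#                      ≈⟨ +-congʳ (+-congˡ (geometric≈[w-1]*geometricSums+n w n)) ⟩
    ((w - 1#) * g + ((w - 1#) * s + n × 1#)) + 1#  ≈⟨ +-congʳ (+-assoc _ _ (n × 1#)) ⟨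
    (((w - 1#) * g + (w - 1#) * s) + n × 1#) + 1#  ≈⟨ +-assoc _ (n × 1#) 1# ⟩
    ((w - 1#) * g + (w - 1#) * s) + (n × 1# + 1#)  ≈⟨ +-cong (distribˡ (w - 1#) g s) (+-comm 1# (n × 1#)) ⟨
    (w - 1#) * (g + s) + (1# + n × 1#)            ∎
    where g = geometric w n
          s = geometricSums w n

  ^-inverse : ∀ {w w'} → w * w' ≈ 1# → ∀ n → w ^ n * w' ^ n ≈ 1#
  ^-inverse w*w'≈1 zero = *-identityˡ 1#
  ^-inverse {w} {w'} w*w'≈1 (suc n) = begin
    (w * w ^ n) * (w' * w' ^ n)  ≈⟨ interchange w (w ^ n) w' (w' ^ n) ⟩
    (w * w') * (w ^ n * w' ^ n)  ≈⟨ *-cong w*w'≈1 (^-inverse w*w'≈1 n) ⟩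
    1# * 1#                      ≈⟨ *-identityˡ 1# ⟩
    1#                           ∎

  record ResidueWitness (w a : Carrier) : Set (c ⊔ ℓ) where
    field
      u v g h     : Carrier
      u*v≈1       : u * v ≈ 1#
      u≈[w-1]*g+1 : u ≈ (w - 1#) * g + 1#
      g≈[w-1]*h+a : g ≈ (w - 1#) * h + a

  GeometricResidue : Carrier → Set (c ⊔ ℓ)
  GeometricResidue a = ∀ w → (∃ λ w' → w * w' ≈ 1#) → ResidueWitness w a

  geometricResidue-resp : ∀ {a b} → a ≈ b → GeometricResidue a → GeometricResidue b
  geometricResidue-resp a≈b residue w unit = record
    { u = u ; v = v ; g = g ; h = h
    ; u*v≈1       = u*v≈1
    ; u≈[w-1]*g+1 = u≈[w-1]*g+1
    ; g≈[w-1]*h+a = trans g≈[w-1]*h+a (+-congˡ a≈b)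
    }
    where open ResidueWitness (residue w unit)

  ×1-geometricResidue : ∀ n → GeometricResidue (n × 1#)
  ×1-geometricResidue n w (w' , w*w'≈1) = record
    { u = w ^ n ; v = w' ^ n ; g = geometric w n ; h = geometricSums w n
    ; u*v≈1       = ^-inverse w*w'≈1 n
    ; u≈[w-1]*g+1 = ^≈[w-1]*geometric+1 w n
    ; g≈[w-1]*h+a = geometric≈[w-1]*geometricSums+n w n
    }

open import Data.Integer using (ℤ; 0ℤ; 1ℤ; _+_; _*_; -_; _-_)
open import Data.Product using (_×_)
open import Relation.Binary.PropositionalEquality

Exp : ℕ → Set
Exp k = Vec ℤ k

infixl 6 _⊹_

_⊹_ : ∀ {k} → Exp k → Exp k → Exp k
_⊹_ = zipWith _+_

0v : ∀ {k} → Exp k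
0v {k} = replicate k 0ℤ

infix 4 _≟v_

-- The decision procedure coeff splits on, so that `with d ≟v e` unfolds coeff.
_≟v_ : ∀ {k} → (d e : Exp k) → Dec (d ≡ e)
_≟v_ = Vec.≡-dec ℤ._≟_

negv : ∀ {k} → Exp k → Exp k
negv = Vec.map (λ x → - x)

module _ {k : ℕ} where

  ⊹-comm : ∀ (d e : Exp k) → d ⊹ e ≡ e ⊹ d
  ⊹-comm = Vec.zipWith-comm ℤ.+-comm

  ⊹-assoc : ∀ (d e f : Exp k) → (d ⊹ e) ⊹ f ≡ d ⊹ (e ⊹ f)
  ⊹-assoc = Vec.zipWith-assoc ℤ.+-assoc

  ⊹-identityˡ : ∀ (d : Exp k) → 0v ⊹ d ≡ d
  ⊹-identityˡ = Vec.zipWith-identityˡ ℤ.+-identityˡ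

  negv-⊹-cancel : ∀ (f d : Exp k) → negv f ⊹ (f ⊹ d) ≡ d
  negv-⊹-cancel f d = begin
    negv f ⊹ (f ⊹ d)   ≡⟨ ⊹-assoc (negv f) f d ⟨
    (negv f ⊹ f) ⊹ d   ≡⟨ cong (_⊹ d) (Vec.zipWith-inverseˡ ℤ.+-inverseˡ f) ⟩
    0v ⊹ d             ≡⟨ ⊹-identityˡ d ⟩
    d                  ∎
    where open ≡-Reasoning

  ⊹-cancelˡ : ∀ (f : Exp k) {d e} → f ⊹ d ≡ f ⊹ e → d ≡ e
  ⊹-cancelˡ f {d} {e} eq =
    trans (sym (negv-⊹-cancel f d)) (trans (cong (negv f ⊹_) eq) (negv-⊹-cancel f e))

𝟙 : ∀ {P : Set} → Dec P → ℤ
𝟙 (yes _) = 1ℤ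
𝟙 (no _)  = 0ℤ

𝟙-yes : ∀ {P : Set} (P? : Dec P) → P → 𝟙 P? ≡ 1ℤ
𝟙-yes (yes _) _  = refl
𝟙-yes (no ¬P) p = ⊥-elim (¬P p)

𝟙-no : ∀ {P : Set} (P? : Dec P) → ¬ P → 𝟙 P? ≡ 0ℤ
𝟙-no (yes p) ¬P = ⊥-elim (¬P p)
𝟙-no (no _)  _  = refl

𝟙-cong : ∀ {P Q : Set} → (P → Q) → (Q → P) → (P? : Dec P) (Q? : Dec Q) → 𝟙 P? ≡ 𝟙 Q?
𝟙-cong P⇒Q Q⇒P (yes p) Q? = sym (𝟙-yes Q? (P⇒Q p))
𝟙-cong P⇒Q Q⇒P (no ¬p) Q? = sym (𝟙-no Q? (λ q → ¬p (Q⇒P q)))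

δ : ∀ {k} → Exp k → Exp k → ℤ
δ e d = 𝟙 (d ≟v e)

⟪_⟫ : ∀ {k} → (Exp k → ℤ) → Laurent k → ℤ
⟪ h ⟫ []            = 0ℤ
⟪ h ⟫ ((c , d) ∷ p) = c * h d + ⟪ h ⟫ p

module _ {k : ℕ} where

  coeff-++ : (p q : Laurent k) (e : Exp k) → coeff (p ++ q) e ≡ coeff p e + coeff q e
  coeff-++ [] q e = sym (ℤ.+-identityˡ _)
  coeff-++ ((c , d) ∷ p) q e with d ≟v e
  ... | yes _ = trans (cong (c +_) (coeff-++ p q e)) (sym (ℤ.+-assoc c _ _))
  ... | no  _ = coeff-++ p q e

  coeff-negL : (p : Laurent k) (e : Exp k) → coeff (negL p) e ≡ - coeff p e
  coeff-negL [] e = refl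
  coeff-negL ((c , d) ∷ p) e with d ≟v e
  ... | yes _ = trans (cong (- c +_) (coeff-negL p e)) (sym (ℤ.neg-distrib-+ c _))
  ... | no  _ = coeff-negL p e

  coeff≡⟪δ⟫ : (p : Laurent k) (e : Exp k) → coeff p e ≡ ⟪ δ e ⟫ p
  coeff≡⟪δ⟫ [] e = refl
  coeff≡⟪δ⟫ ((c , d) ∷ p) e with d ≟v e
  ... | yes _ = cong₂ _+_ (sym (ℤ.*-identityʳ c)) (coeff≡⟪δ⟫ p e)
  ... | no  _ = trans (coeff≡⟪δ⟫ p e) (sym (trans (cong (_+ _) (ℤ.*-zeroʳ c)) (ℤ.+-identityˡ _)))

  ⟪⟫-ext : ∀ {f g : Exp k → ℤ} (p : Laurent k) → (∀ d → f d ≡ g d) → ⟪ f ⟫ p ≡ ⟪ g ⟫ p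
  ⟪⟫-ext [] f≗g = refl
  ⟪⟫-ext ((c , d) ∷ p) f≗g = cong₂ _+_ (cong (c *_) (f≗g d)) (⟪⟫-ext p f≗g)

  ⟪⟫-zero : (p : Laurent k) → ⟪ (λ _ → 0ℤ) ⟫ p ≡ 0ℤ
  ⟪⟫-zero [] = refl
  ⟪⟫-zero ((c , d) ∷ p) = trans (cong₂ _+_ (ℤ.*-zeroʳ c) (⟪⟫-zero p)) refl

  ⟪⟫-linear : ∀ m (f g : Exp k → ℤ) (p : Laurent k) →
              ⟪ (λ d → m * f d + g d) ⟫ p ≡ m * ⟪ f ⟫ p + ⟪ g ⟫ p
  ⟪⟫-linear m f g [] = cong (_+ 0ℤ) (sym (ℤ.*-zeroʳ m))
  ⟪⟫-linear m f g ((c , d) ∷ p) =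
    trans (cong (c * (m * f d + g d) +_) (⟪⟫-linear m f g p)) (expand c m (f d) (g d) _ _)
    where
    expand : ∀ c m x y s t → c * (m * x + y) + (m * s + t) ≡ m * (c * x + s) + (c * y + t)
    expand = solve-∀

  ⟪⟫-scale : ∀ m (f : Exp k → ℤ) (p : Laurent k) → ⟪ (λ d → m * f d) ⟫ p ≡ m * ⟪ f ⟫ p
  ⟪⟫-scale m f p = begin
    ⟪ (λ d → m * f d) ⟫ p             ≡⟨ ⟪⟫-ext p (λ d → sym (ℤ.+-identityʳ (m * f d))) ⟩
    ⟪ (λ d → m * f d + 0ℤ) ⟫ p        ≡⟨ ⟪⟫-linear m f (λ _ → 0ℤ) p ⟩
    m * ⟪ f ⟫ p + ⟪ (λ _ → 0ℤ) ⟫ p    ≡⟨ cong (m * ⟪ f ⟫ p +_) (⟪⟫-zero p) ⟩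
    m * ⟪ f ⟫ p + 0ℤ                  ≡⟨ ℤ.+-identityʳ _ ⟩
    m * ⟪ f ⟫ p                       ∎
    where open ≡-Reasoning

  ⟪⟫-++ : ∀ h (p q : Laurent k) → ⟪ h ⟫ (p ++ q) ≡ ⟪ h ⟫ p + ⟪ h ⟫ q
  ⟪⟫-++ h [] q = sym (ℤ.+-identityˡ _)
  ⟪⟫-++ h ((c , d) ∷ p) q = trans (cong (c * h d +_) (⟪⟫-++ h p q)) (sym (ℤ.+-assoc (c * h d) _ _))

  ⟪⟫-negL : ∀ h (p : Laurent k) → ⟪ h ⟫ (negL p) ≡ - ⟪ h ⟫ p
  ⟪⟫-negL h [] = refl
  ⟪⟫-negL h ((c , d) ∷ p) =
    trans (cong₂ _+_ (sym (ℤ.neg-distribˡ-* c (h d))) (⟪⟫-negL h p)) (sym (ℤ.neg-distrib-+ (c * h d) _))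

  coeff-constL : ∀ c (e : Exp k) → coeff (constL c) e ≡ c * δ e 0v
  coeff-constL c e with 0v ≟v e
  ... | yes _ = trans (ℤ.+-identityʳ c) (sym (ℤ.*-identityʳ c))
  ... | no  _ = sym (ℤ.*-zeroʳ c)

  coeff-constL-0v : ∀ c → coeff {k} (constL c) 0v ≡ c
  coeff-constL-0v c =
    trans (coeff-constL c 0v) (trans (cong (c *_) (𝟙-yes (0v ≟v 0v) refl)) (ℤ.*-identityʳ c))

  coeff-constL-≢0v : ∀ c {e : Exp k} → e ≢ 0v → coeff (constL c) e ≡ 0ℤ
  coeff-constL-≢0v c {e} e≢0 =
    trans (coeff-constL c e) (trans (cong (c *_) (𝟙-no (0v ≟v e) (λ 0≡e → e≢0 (sym 0≡e)))) (ℤ.*-zeroʳ c))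

  coeff-oneL-support : ∀ (e : Exp k) → coeff oneL e ≢ 0ℤ → e ≡ 0v
  coeff-oneL-support e 1≢0 = decidable-stable (e ≟v 0v) (λ e≢0 → 1≢0 (coeff-constL-≢0v 1ℤ e≢0))

  coeff-∷-same : ∀ c d (q : Laurent k) → coeff ((c , d) ∷ q) d ≡ c + coeff q d
  coeff-∷-same c d q with d ≟v d
  ... | yes _  = refl
  ... | no d≢d = ⊥-elim (d≢d refl)

  coeff-∷-other : ∀ c d (q : Laurent k) {e} → d ≢ e → coeff ((c , d) ∷ q) e ≡ coeff q e
  coeff-∷-other c d q {e} d≢e with d ≟v e
  ... | yes d≡e = ⊥-elim (d≢e d≡e)
  ... | no  _   = refl

  _except_ : (Exp k → ℤ) → Exp k → Exp k → ℤ
  (h except d) d' with d' ≟v d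
  ... | yes _ = 0ℤ
  ... | no  _ = h d'

  ⟪⟫-except : ∀ h d (p : Laurent k) → ⟪ h ⟫ p ≡ coeff p d * h d + ⟪ h except d ⟫ p
  ⟪⟫-except h d [] = sym (ℤ.+-identityʳ (0ℤ * h d))
  ⟪⟫-except h d ((c , d') ∷ p) with d' ≟v d
  ... | yes refl = trans (cong (c * h d +_) (⟪⟫-except h d p)) (regroup c (h d) (coeff p d) _)
    where
    regroup : ∀ c x y z → c * x + (y * x + z) ≡ (c + y) * x + (c * 0ℤ + z)
    regroup = solve-∀
  ... | no  _    = trans (cong (c * h d' +_) (⟪⟫-except h d p)) (swap (c * h d') (coeff p d * h d) _)
    where
    swap : ∀ x y z → x + (y + z) ≡ y + (x + z)
    swap = solve-∀

  ⟪⟫-vanishing : ∀ h (p : Laurent k) → (∀ d → coeff p d ≢ 0ℤ → h d ≡ 0ℤ) → ⟪ h ⟫ p ≡ 0ℤ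
  ⟪⟫-vanishing h [] _ = refl
  ⟪⟫-vanishing h ((c , d) ∷ q) h-vanishes = begin
    c * h d + ⟪ h ⟫ q
      ≡⟨ cong (c * h d +_) (⟪⟫-except h d q) ⟩
    c * h d + (coeff q d * h d + ⟪ h except d ⟫ q)
      ≡⟨ regroup c (coeff q d) (h d) _ ⟩
    (c + coeff q d) * h d + ⟪ h except d ⟫ q
      ≡⟨ cong₂ _+_ head-vanishes (⟪⟫-vanishing (h except d) q tail-vanishes) ⟩
    0ℤ
      ∎
    where
    open ≡-Reasoning
    regroup : ∀ c y x z → c * x + (y * x + z) ≡ (c + y) * x + z
    regroup = solve-∀
    head-vanishes : (c + coeff q d) * h d ≡ 0ℤ
    head-vanishes with c + coeff q d ℤ.≟ 0ℤ
    ... | yes c+q≡0 = trans (cong (_* h d) c+q≡0) (ℤ.*-zeroˡ (h d))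
    ... | no  c+q≢0 = trans (cong ((c + coeff q d) *_) (h-vanishes d p≢0)) (ℤ.*-zeroʳ (c + coeff q d))
      where
      p≢0 : coeff ((c , d) ∷ q) d ≢ 0ℤ
      p≢0 p≡0 = c+q≢0 (trans (sym (coeff-∷-same c d q)) p≡0)
    tail-vanishes : ∀ d' → coeff q d' ≢ 0ℤ → (h except d) d' ≡ 0ℤ
    tail-vanishes d' q≢0 with d' ≟v d
    ... | yes _    = refl
    ... | no d'≢d =
      h-vanishes d' (λ p≡0 → q≢0 (trans (sym (coeff-∷-other c d q (λ d≡d' → d'≢d (sym d≡d')))) p≡0))

  ⟪⟫-support : ∀ (f g : Exp k → ℤ) (p : Laurent k) →
               (∀ d → coeff p d ≢ 0ℤ → f d ≡ g d) → ⟪ f ⟫ p ≡ ⟪ g ⟫ p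
  ⟪⟫-support f g p f≗g = begin
    ⟪ f ⟫ p                               ≡⟨ split (⟪ f ⟫ p) (⟪ g ⟫ p) ⟩
    ⟪ g ⟫ p + (- 1ℤ * ⟪ g ⟫ p + ⟪ f ⟫ p)  ≡⟨ cong (⟪ g ⟫ p +_) (⟪⟫-linear (- 1ℤ) g f p) ⟨
    ⟪ g ⟫ p + ⟪ difference ⟫ p
      ≡⟨ cong (⟪ g ⟫ p +_) (⟪⟫-vanishing difference p difference-vanishes) ⟩
    ⟪ g ⟫ p + 0ℤ                          ≡⟨ ℤ.+-identityʳ _ ⟩
    ⟪ g ⟫ p                               ∎
    where
    open ≡-Reasoning
    split : ∀ x y → x ≡ y + (- 1ℤ * y + x)
    split = solve-∀
    difference : Exp k → ℤ
    difference d = - 1ℤ * g d + f d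
    difference-vanishes : ∀ d → coeff p d ≢ 0ℤ → difference d ≡ 0ℤ
    difference-vanishes d p≢0 rewrite f≗g d p≢0 =
      trans (cong (_+ g d) (ℤ.-1*i≡-i (g d))) (ℤ.+-inverseˡ (g d))

  ⟪⟫-cong : ∀ h (p q : Laurent k) → p ≈L q → ⟪ h ⟫ p ≡ ⟪ h ⟫ q
  ⟪⟫-cong h p q p≈q = ℤ.i-j≡0⇒i≡j _ _ (begin
    ⟪ h ⟫ p - ⟪ h ⟫ q              ≡⟨ cong (⟪ h ⟫ p +_) (⟪⟫-negL h q) ⟨
    ⟪ h ⟫ p + ⟪ h ⟫ (negL q)       ≡⟨ ⟪⟫-++ h p (negL q) ⟨
    ⟪ h ⟫ (p ++ negL q)            ≡⟨ ⟪⟫-vanishing h (p ++ negL q) (λ d nz → ⊥-elim (nz (no-coefficients d))) ⟩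
    0ℤ                             ∎)
    where
    open ≡-Reasoning
    no-coefficients : ∀ d → coeff (p ++ negL q) d ≡ 0ℤ
    no-coefficients d = trans (coeff-++ p (negL q) d)
      (trans (cong (coeff p d +_) (coeff-negL q d)) (ℤ.i≡j⇒i-j≡0 (p≈q d)))

  -- Stated for every t with this behaviour, since mulL maps an anonymous function over q.
  ⟪⟫-map-translate : ∀ h c d (t : Mono k → Mono k) → (∀ c' d' → t (c' , d') ≡ (c * c' , d ⊹ d')) →
                     ∀ q → ⟪ h ⟫ (map t q) ≡ c * ⟪ (λ d' → h (d ⊹ d')) ⟫ q
  ⟪⟫-map-translate h c d t t-spec [] = sym (ℤ.*-zeroʳ c)
  ⟪⟫-map-translate h c d t t-spec ((c' , d') ∷ q) rewrite t-spec c' d' =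
    trans (cong ((c * c') * h (d ⊹ d') +_) (⟪⟫-map-translate h c d t t-spec q))
          (reassociate c c' (h (d ⊹ d')) _)
    where
    reassociate : ∀ c c' x y → (c * c') * x + c * y ≡ c * (c' * x + y)
    reassociate = solve-∀

  ⟪⟫-mulL : ∀ h (p q : Laurent k) →
            ⟪ h ⟫ (mulL p q) ≡ ⟪ (λ d → ⟪ (λ d' → h (d ⊹ d')) ⟫ q) ⟫ p
  ⟪⟫-mulL h [] q = refl
  ⟪⟫-mulL h ((c , d) ∷ p) q =
    trans (⟪⟫-++ h (map _ q) (mulL p q))
          (cong₂ _+_ (⟪⟫-map-translate h c d _ (λ _ _ → refl) q) (⟪⟫-mulL h p q))

  ⟪⟫-swap : ∀ (H : Exp k → Exp k → ℤ) (p q : Laurent k) →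
            ⟪ (λ d → ⟪ H d ⟫ q) ⟫ p ≡ ⟪ (λ d' → ⟪ (λ d → H d d') ⟫ p) ⟫ q
  ⟪⟫-swap H [] q = sym (⟪⟫-zero q)
  ⟪⟫-swap H ((c , d) ∷ p) q =
    trans (cong (c * ⟪ H d ⟫ q +_) (⟪⟫-swap H p q))
          (sym (⟪⟫-linear c (H d) (λ d' → ⟪ (λ d₀ → H d₀ d') ⟫ p) q))

infix 4 _≋_

-- A record rather than _≈L_ itself, so that p and q can be inferred from a proof of p ≋ q.
record _≋_ {k} (p q : Laurent k) : Set where
  constructor mk≋
  field coefficients : p ≈L q

open _≋_

module _ {k : ℕ} where

  ≋-isEquivalence : IsEquivalence (_≋_ {k})
  ≋-isEquivalence = record
    { refl  = mk≋ λ _ → refl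
    ; sym   = λ p≋q → mk≋ λ e → sym (coefficients p≋q e)
    ; trans = λ p≋q q≋r → mk≋ λ e → trans (coefficients p≋q e) (coefficients q≋r e)
    }

  open IsEquivalence ≋-isEquivalence public
    using () renaming (refl to ≋-refl; sym to ≋-sym; trans to ≋-trans)

  ≋-setoid : Setoid 0ℓ 0ℓ
  ≋-setoid = record { isEquivalence = ≋-isEquivalence }

  private
    ≋-from-⟪⟫ : ∀ (p q : Laurent k) → (∀ h → ⟪ h ⟫ p ≡ ⟪ h ⟫ q) → p ≋ q
    ≋-from-⟪⟫ p q same = mk≋ λ e → trans (coeff≡⟪δ⟫ p e) (trans (same (δ e)) (sym (coeff≡⟪δ⟫ q e)))


  +-cong : ∀ {p p' q q' : Laurent k} → p ≋ p' → q ≋ q' → addL p q ≋ addL p' q'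
  +-cong {p} {p'} {q} {q'} p≋p' q≋q' = mk≋ λ e → begin
    coeff (p ++ q) e        ≡⟨ coeff-++ p q e ⟩
    coeff p e + coeff q e   ≡⟨ cong₂ _+_ (coefficients p≋p' e) (coefficients q≋q' e) ⟩
    coeff p' e + coeff q' e ≡⟨ coeff-++ p' q' e ⟨
    coeff (p' ++ q') e      ∎
    where open ≡-Reasoning

  +-assoc : ∀ (p q r : Laurent k) → addL (addL p q) r ≋ addL p (addL q r)
  +-assoc p q r = mk≋ λ e → cong (λ s → coeff s e) (List.++-assoc p q r)

  +-identityˡ : ∀ (p : Laurent k) → addL zeroL p ≋ p
  +-identityˡ p = mk≋ λ _ → refl

  +-comm : ∀ (p q : Laurent k) → addL p q ≋ addL q p
  +-comm p q = mk≋ λ e →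
    trans (coeff-++ p q e) (trans (ℤ.+-comm (coeff p e) (coeff q e)) (sym (coeff-++ q p e)))

  -‿inverseˡ : ∀ (p : Laurent k) → addL (negL p) p ≋ zeroL
  -‿inverseˡ p = mk≋ λ e → begin
    coeff (negL p ++ p) e          ≡⟨ coeff-++ (negL p) p e ⟩
    coeff (negL p) e + coeff p e   ≡⟨ cong (_+ coeff p e) (coeff-negL p e) ⟩
    - coeff p e + coeff p e        ≡⟨ ℤ.+-inverseˡ (coeff p e) ⟩
    0ℤ                             ∎
    where open ≡-Reasoning

  -‿cong : ∀ {p q : Laurent k} → p ≋ q → negL p ≋ negL q
  -‿cong {p} {q} p≋q = mk≋ λ e →
    trans (coeff-negL p e) (trans (cong -_ (coefficients p≋q e)) (sym (coeff-negL q e)))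

  *-cong : ∀ {p p' q q' : Laurent k} → p ≋ p' → q ≋ q' → mulL p q ≋ mulL p' q'
  *-cong {p} {p'} {q} {q'} p≋p' q≋q' = ≋-from-⟪⟫ (mulL p q) (mulL p' q') λ h → begin
    ⟪ h ⟫ (mulL p q)                          ≡⟨ ⟪⟫-mulL h p q ⟩
    ⟪ (λ d → ⟪ (λ d' → h (d ⊹ d')) ⟫ q) ⟫ p   ≡⟨ ⟪⟫-cong _ p p' (coefficients p≋p') ⟩
    ⟪ (λ d → ⟪ (λ d' → h (d ⊹ d')) ⟫ q) ⟫ p'  ≡⟨ ⟪⟫-ext p' (λ d → ⟪⟫-cong _ q q' (coefficients q≋q')) ⟩
    ⟪ (λ d → ⟪ (λ d' → h (d ⊹ d')) ⟫ q') ⟫ p' ≡⟨ ⟪⟫-mulL h p' q' ⟨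
    ⟪ h ⟫ (mulL p' q')                        ∎
    where open ≡-Reasoning

  *-comm : ∀ (p q : Laurent k) → mulL p q ≋ mulL q p
  *-comm p q = ≋-from-⟪⟫ (mulL p q) (mulL q p) λ h → begin
    ⟪ h ⟫ (mulL p q)                          ≡⟨ ⟪⟫-mulL h p q ⟩
    ⟪ (λ d → ⟪ (λ d' → h (d ⊹ d')) ⟫ q) ⟫ p   ≡⟨ ⟪⟫-swap (λ d d' → h (d ⊹ d')) p q ⟩
    ⟪ (λ d' → ⟪ (λ d → h (d ⊹ d')) ⟫ p) ⟫ q
      ≡⟨ ⟪⟫-ext q (λ d' → ⟪⟫-ext p (λ d → cong h (⊹-comm d d'))) ⟩
    ⟪ (λ d' → ⟪ (λ d → h (d' ⊹ d)) ⟫ p) ⟫ q   ≡⟨ ⟪⟫-mulL h q p ⟨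
    ⟪ h ⟫ (mulL q p)                          ∎
    where open ≡-Reasoning

  *-assoc : ∀ (p q r : Laurent k) → mulL (mulL p q) r ≋ mulL p (mulL q r)
  *-assoc p q r = ≋-from-⟪⟫ (mulL (mulL p q) r) (mulL p (mulL q r)) λ h → begin
    ⟪ h ⟫ (mulL (mulL p q) r)
      ≡⟨ ⟪⟫-mulL h (mulL p q) r ⟩
    ⟪ (λ d → ⟪ (λ d'' → h (d ⊹ d'')) ⟫ r) ⟫ (mulL p q)
      ≡⟨ ⟪⟫-mulL _ p q ⟩
    ⟪ (λ d → ⟪ (λ d' → ⟪ (λ d'' → h ((d ⊹ d') ⊹ d'')) ⟫ r) ⟫ q) ⟫ p
      ≡⟨ ⟪⟫-ext p (λ d → ⟪⟫-ext q (λ d' → ⟪⟫-ext r (λ d'' → cong h (⊹-assoc d d' d'')))) ⟩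
    ⟪ (λ d → ⟪ (λ d' → ⟪ (λ d'' → h (d ⊹ (d' ⊹ d''))) ⟫ r) ⟫ q) ⟫ p
      ≡⟨ ⟪⟫-ext p (λ d → ⟪⟫-mulL (λ d' → h (d ⊹ d')) q r) ⟨
    ⟪ (λ d → ⟪ (λ d' → h (d ⊹ d')) ⟫ (mulL q r)) ⟫ p
      ≡⟨ ⟪⟫-mulL h p (mulL q r) ⟨
    ⟪ h ⟫ (mulL p (mulL q r))
      ∎
    where open ≡-Reasoning

  *-identityˡ : ∀ (p : Laurent k) → mulL oneL p ≋ p
  *-identityˡ p = ≋-from-⟪⟫ (mulL oneL p) p λ h → begin
    ⟪ h ⟫ (mulL oneL p)                        ≡⟨ ⟪⟫-mulL h oneL p ⟩
    1ℤ * ⟪ (λ d → h (0v ⊹ d)) ⟫ p + 0ℤ          ≡⟨ ℤ.+-identityʳ _ ⟩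
    1ℤ * ⟪ (λ d → h (0v ⊹ d)) ⟫ p               ≡⟨ ℤ.*-identityˡ _ ⟩
    ⟪ (λ d → h (0v ⊹ d)) ⟫ p                    ≡⟨ ⟪⟫-ext p (λ d → cong h (⊹-identityˡ d)) ⟩
    ⟪ h ⟫ p                                     ∎
    where open ≡-Reasoning

  *-distribʳ : ∀ (p q r : Laurent k) → mulL (addL q r) p ≋ addL (mulL q p) (mulL r p)
  *-distribʳ p q r = mk≋ λ e → cong (λ s → coeff s e) (List.concatMap-++ _ q r)

laurentRing : ℕ → CommutativeRing 0ℓ 0ℓ
laurentRing k = record
  { Carrier = Laurent k
  ; _≈_ = _≋_
  ; _+_ = addL
  ; _*_ = mulL
  ; -_ = negL
  ; 0# = zeroL
  ; 1# = oneL
  ; isCommutativeRing = record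
    { isRing = record
      { +-isAbelianGroup = record
        { isGroup = record
          { isMonoid = record
            { isSemigroup = record
              { isMagma = record { isEquivalence = ≋-isEquivalence ; ∙-cong = +-cong }
              ; assoc = +-assoc
              }
            ; identity = comm∧idˡ⇒id +-comm +-identityˡ
            }
          ; inverse = comm∧invˡ⇒inv +-comm -‿inverseˡ
          ; ⁻¹-cong = -‿cong
          }
        ; comm = +-comm
        }
      ; *-cong = *-cong
      ; *-assoc = *-assoc
      ; *-identity = comm∧idˡ⇒id *-comm *-identityˡ
      ; distrib = comm∧distrʳ⇒distr +-cong *-comm *-distribʳ
      }
    ; *-comm = *-comm
    }
  }
  where open AlgebraConsequences ≋-setoid

module ExtremalExponents {k ℓ} {_≤_ : Rel (Exp k) ℓ}
  (≤-antisym : Antisymmetric _≡_ _≤_) (⊹-monoˡ-≤ : ∀ f {d e} → d ≤ e → (f ⊹ d) ≤ (f ⊹ e)) where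

  BoundsSupport : Laurent k → Exp k → Set ℓ
  BoundsSupport p T = ∀ d → coeff p d ≢ 0ℤ → d ≤ T

  extremal-sum : ∀ {d d' T T'} → d ≤ T → d' ≤ T' → d ⊹ d' ≡ T ⊹ T' → d ≡ T
  extremal-sum {d} {d'} {T} {T'} d≤T d'≤T' sum≡ = ≤-antisym d≤T T≤d
    where
    T'+T≤T'+d : (T' ⊹ T) ≤ (T' ⊹ d)
    T'+T≤T'+d = subst₂ _≤_ (trans sum≡ (⊹-comm T T')) (⊹-comm d T') (⊹-monoˡ-≤ d d'≤T')
    T≤d : T ≤ d
    T≤d = subst₂ _≤_ (negv-⊹-cancel T' T) (negv-⊹-cancel T' d) (⊹-monoˡ-≤ (negv T') T'+T≤T'+d)

  δ-⊹ : ∀ {d d' T T'} → d ≤ T → d' ≤ T' → δ (T ⊹ T') (d ⊹ d') ≡ δ T' d' * δ T d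
  δ-⊹ {d} {d'} {T} {T'} d≤T d'≤T' with d ≟v T
  ... | no d≢T = trans (𝟙-no (d ⊹ d' ≟v T ⊹ T') (λ sum≡ → d≢T (extremal-sum d≤T d'≤T' sum≡)))
                       (sym (ℤ.*-zeroʳ (δ T' d')))
  ... | yes refl = trans (𝟙-cong (⊹-cancelˡ d) (cong (d ⊹_)) (d ⊹ d' ≟v d ⊹ T') (d' ≟v T'))
                         (sym (ℤ.*-identityʳ (δ T' d')))

  coeff-mulL-extremal : ∀ (p q : Laurent k) {T T'} → BoundsSupport p T → BoundsSupport q T' →
                        coeff (mulL p q) (T ⊹ T') ≡ coeff p T * coeff q T'
  coeff-mulL-extremal p q {T} {T'} p≤T q≤T' = begin
    coeff (mulL p q) (T ⊹ T')                           ≡⟨ coeff≡⟪δ⟫ (mulL p q) (T ⊹ T') ⟩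
    ⟪ δ (T ⊹ T') ⟫ (mulL p q)                           ≡⟨ ⟪⟫-mulL (δ (T ⊹ T')) p q ⟩
    ⟪ (λ d → ⟪ (λ d' → δ (T ⊹ T') (d ⊹ d')) ⟫ q) ⟫ p    ≡⟨ ⟪⟫-support _ _ p inner ⟩
    ⟪ (λ d → coeff q T' * δ T d) ⟫ p                    ≡⟨ ⟪⟫-scale (coeff q T') (δ T) p ⟩
    coeff q T' * ⟪ δ T ⟫ p                              ≡⟨ cong (coeff q T' *_) (coeff≡⟪δ⟫ p T) ⟨
    coeff q T' * coeff p T                              ≡⟨ ℤ.*-comm (coeff q T') (coeff p T) ⟩
    coeff p T * coeff q T'                              ∎
    where
    open ≡-Reasoning
    inner : ∀ d → coeff p d ≢ 0ℤ → ⟪ (λ d' → δ (T ⊹ T') (d ⊹ d')) ⟫ q ≡ coeff q T' * δ T d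
    inner d p≢0 = begin
      ⟪ (λ d' → δ (T ⊹ T') (d ⊹ d')) ⟫ q   ≡⟨ ⟪⟫-support _ _ q (λ d' q≢0 → δ-⊹ (p≤T d p≢0) (q≤T' d' q≢0)) ⟩
      ⟪ (λ d' → δ T' d' * δ T d) ⟫ q       ≡⟨ ⟪⟫-ext q (λ d' → ℤ.*-comm (δ T' d') (δ T d)) ⟩
      ⟪ (λ d' → δ T d * δ T' d') ⟫ q       ≡⟨ ⟪⟫-scale (δ T d) (δ T') q ⟩
      δ T d * ⟪ δ T' ⟫ q                   ≡⟨ cong (δ T d *_) (coeff≡⟪δ⟫ q T') ⟨
      δ T d * coeff q T'                   ≡⟨ ℤ.*-comm (δ T d) (coeff q T') ⟩
      coeff q T' * δ T d                   ∎

  unit-extremal-sum≡0 : ∀ (p q : Laurent k) {T T'} → mulL p q ≋ oneL →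
                  BoundsSupport p T → coeff p T ≢ 0ℤ → BoundsSupport q T' → coeff q T' ≢ 0ℤ → T ⊹ T' ≡ 0v
  unit-extremal-sum≡0 p q {T} {T'} pq≋1 p≤T pT≢0 q≤T' qT'≢0 = coeff-oneL-support (T ⊹ T') λ 1≡0 →
    [ pT≢0 , qT'≢0 ]′ (ℤ.i*j≡0⇒i≡0∨j≡0 (coeff p T)
      (trans (sym (coeff-mulL-extremal p q p≤T q≤T')) (trans (coefficients pq≋1 (T ⊹ T')) 1≡0)))

module _ {k : ℕ} where

  support : Laurent k → List (Exp k)
  support p = filter (λ d → ¬? (coeff p d ℤ.≟ 0ℤ)) (map proj₂ p)

  ∈-exponents : ∀ (p : Laurent k) {d} → coeff p d ≢ 0ℤ → d ∈ map proj₂ p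
  ∈-exponents [] 0≢0 = ⊥-elim (0≢0 refl)
  ∈-exponents ((c , d') ∷ p) {d} p≢0 with d' ≟v d
  ... | yes d'≡d = here (sym d'≡d)
  ... | no  _    = there (∈-exponents p p≢0)

  ∈-support : ∀ (p : Laurent k) {d} → coeff p d ≢ 0ℤ → d ∈ support p
  ∈-support p p≢0 = ∈-filter⁺ (λ d → ¬? (coeff p d ℤ.≟ 0ℤ)) (∈-exponents p p≢0) p≢0

  unit-nonzero : ∀ (p q : Laurent k) → mulL p q ≋ oneL → ∃ λ d → coeff p d ≢ 0ℤ
  unit-nonzero p q pq≋1 with any? (λ d → ¬? (coeff p d ℤ.≟ 0ℤ)) (map proj₂ p)
  ... | yes found = satisfied found
  ... | no  none  = ⊥-elim (1≢0 (begin
    1ℤ                                              ≡⟨ coeff-constL-0v {k} 1ℤ ⟨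
    coeff (oneL {k}) 0v                             ≡⟨ coefficients pq≋1 0v ⟨
    coeff (mulL p q) 0v                             ≡⟨ coeff≡⟪δ⟫ (mulL p q) 0v ⟩
    ⟪ δ 0v ⟫ (mulL p q)                             ≡⟨ ⟪⟫-mulL (δ 0v) p q ⟩
    ⟪ (λ d → ⟪ (λ d' → δ 0v (d ⊹ d')) ⟫ q) ⟫ p
      ≡⟨ ⟪⟫-vanishing _ p (λ d p≢0 → ⊥-elim (none (lose (∈-exponents p p≢0) p≢0))) ⟩
    0ℤ                                              ∎))
    where
    open ≡-Reasoning
    1≢0 : 1ℤ ≢ 0ℤ
    1≢0 ()

  lexOrder : TotalOrder 0ℓ 0ℓ 0ℓ
  lexOrder = Lex.≤-totalOrder ℤ.<-strictTotalOrder k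

  open TotalOrder lexOrder using (_≤_)
  open Extrema lexOrder using (max; min; xs≤max; min≤xs; argmax-all; argmin-all)

  lex-antisym : Antisymmetric _≡_ _≤_
  lex-antisym d≤e e≤d = Pointwise-≡⇒≡ (TotalOrder.antisym lexOrder d≤e e≤d)

  lex-⊹-monoˡ : ∀ {m} (f : Exp m) {d e} → Lex.Lex-≤ _≡_ ℤ._<_ d e → Lex.Lex-≤ _≡_ ℤ._<_ (f ⊹ d) (f ⊹ e)
  lex-⊹-monoˡ []      (Lex.base _)        = Lex.base _
  lex-⊹-monoˡ (z ∷ f) (Lex.this x<y refl) = Lex.this (ℤ.+-monoʳ-< z x<y) refl
  lex-⊹-monoˡ (z ∷ f) (Lex.next refl d≤e) = Lex.next refl (lex-⊹-monoˡ f d≤e)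

  module Top    = ExtremalExponents lex-antisym (λ f → lex-⊹-monoˡ f)
  module Bottom = ExtremalExponents (flip lex-antisym) (λ f → lex-⊹-monoˡ f)

  top bottom : Laurent k → Exp k → Exp k
  top    p d₀ = max d₀ (support p)
  bottom p d₀ = min d₀ (support p)

  top-nonzero : ∀ p {d₀} → coeff p d₀ ≢ 0ℤ → coeff p (top p d₀) ≢ 0ℤ
  top-nonzero p p≢0 = argmax-all (λ d → d) p≢0 (all-filter (λ d → ¬? (coeff p d ℤ.≟ 0ℤ)) (map proj₂ p))

  bottom-nonzero : ∀ p {d₀} → coeff p d₀ ≢ 0ℤ → coeff p (bottom p d₀) ≢ 0ℤ
  bottom-nonzero p p≢0 = argmin-all (λ d → d) p≢0 (all-filter (λ d → ¬? (coeff p d ℤ.≟ 0ℤ)) (map proj₂ p))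

  top-bounds : ∀ p d₀ → Top.BoundsSupport p (top p d₀)
  top-bounds p d₀ d p≢0 = All.lookup (xs≤max d₀ (support p)) (∈-support p p≢0)

  bottom-bounds : ∀ p d₀ → Bottom.BoundsSupport p (bottom p d₀)
  bottom-bounds p d₀ d p≢0 = All.lookup (min≤xs d₀ (support p)) (∈-support p p≢0)

  unit-support-singleton : ∀ (p q : Laurent k) → mulL p q ≋ oneL →
                           ∃ λ T → coeff p T ≢ 0ℤ × (∀ d → coeff p d ≢ 0ℤ → d ≡ T)
  unit-support-singleton p q pq≋1
    with unit-nonzero p q pq≋1 | unit-nonzero q p (≋-trans (*-comm q p) pq≋1)
  ... | dp , dp≢0 | dq , dq≢0 = top p dp , top-nonzero p dp≢0 , singleton
    where
    tops : top p dp ⊹ top q dq ≡ 0v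
    tops = Top.unit-extremal-sum≡0 p q pq≋1
      (top-bounds p dp) (top-nonzero p dp≢0) (top-bounds q dq) (top-nonzero q dq≢0)
    bottoms : bottom p dp ⊹ bottom q dq ≡ 0v
    bottoms = Bottom.unit-extremal-sum≡0 p q pq≋1
      (bottom-bounds p dp) (bottom-nonzero p dp≢0) (bottom-bounds q dq) (bottom-nonzero q dq≢0)
    bottom≡top : bottom p dp ≡ top p dp
    bottom≡top = Top.extremal-sum (top-bounds p dp _ (bottom-nonzero p dp≢0))
                                  (top-bounds q dq _ (bottom-nonzero q dq≢0)) (trans bottoms (sym tops))
    singleton : ∀ d → coeff p d ≢ 0ℤ → d ≡ top p dp
    singleton d p≢0 =
      lex-antisym (top-bounds p dp d p≢0) (subst (_≤ d) bottom≡top (bottom-bounds p dp d p≢0))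

monomial : ∀ {k} → Exp k → Laurent k
monomial s = (1ℤ , s) ∷ []

module _ {k : ℕ} where

  ⟪⟫-oneL : ∀ (h : Exp k → ℤ) → ⟪ h ⟫ oneL ≡ h 0v
  ⟪⟫-oneL h = trans (ℤ.+-identityʳ (1ℤ * h 0v)) (ℤ.*-identityˡ (h 0v))

  ⟪⟫-singleton-support : ∀ h (p : Laurent k) {T} → (∀ d → coeff p d ≢ 0ℤ → d ≡ T) →
                         ⟪ h ⟫ p ≡ coeff p T * h T
  ⟪⟫-singleton-support h p {T} ⊆T = begin
    ⟪ h ⟫ p                      ≡⟨ ⟪⟫-support h (λ d → h T * δ T d) p at-T ⟩
    ⟪ (λ d → h T * δ T d) ⟫ p    ≡⟨ ⟪⟫-scale (h T) (δ T) p ⟩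
    h T * ⟪ δ T ⟫ p              ≡⟨ cong (h T *_) (coeff≡⟪δ⟫ p T) ⟨
    h T * coeff p T              ≡⟨ ℤ.*-comm (h T) (coeff p T) ⟩
    coeff p T * h T              ∎
    where
    open ≡-Reasoning
    at-T : ∀ d → coeff p d ≢ 0ℤ → h d ≡ h T * δ T d
    at-T d p≢0 with ⊆T d p≢0
    ... | refl = trans (sym (ℤ.*-identityʳ (h d))) (cong (h d *_) (sym (𝟙-yes (d ≟v d) refl)))

  ⟪⟫-[x^s-1]* : ∀ h s (X : Laurent k) →
                ⟪ h ⟫ (mulL (addL (monomial s) (negL oneL)) X) ≡ ⟪ (λ d → h (s ⊹ d)) ⟫ X - ⟪ h ⟫ X
  ⟪⟫-[x^s-1]* h s X = begin
    ⟪ h ⟫ (mulL (addL (monomial s) (negL oneL)) X)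
      ≡⟨ ⟪⟫-mulL h (addL (monomial s) (negL oneL)) X ⟩
    1ℤ * ⟪ (λ d → h (s ⊹ d)) ⟫ X + (- 1ℤ * ⟪ (λ d → h (0v ⊹ d)) ⟫ X + 0ℤ)
      ≡⟨ cong (λ t → 1ℤ * ⟪ (λ d → h (s ⊹ d)) ⟫ X + (- 1ℤ * t + 0ℤ))
              (⟪⟫-ext X (λ d → cong h (⊹-identityˡ d))) ⟩
    1ℤ * ⟪ (λ d → h (s ⊹ d)) ⟫ X + (- 1ℤ * ⟪ h ⟫ X + 0ℤ)
      ≡⟨ simplify (⟪ (λ d → h (s ⊹ d)) ⟫ X) (⟪ h ⟫ X) ⟩
    ⟪ (λ d → h (s ⊹ d)) ⟫ X - ⟪ h ⟫ X
      ∎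
    where
    open ≡-Reasoning
    simplify : ∀ x y → 1ℤ * x + (- 1ℤ * y + 0ℤ) ≡ x - y
    simplify = solve-∀

  ⟪⟫-periodic : ∀ h s (X : Laurent k) → (∀ d → h (s ⊹ d) ≡ h d) →
                ⟪ h ⟫ (mulL (addL (monomial s) (negL oneL)) X) ≡ 0ℤ
  ⟪⟫-periodic h s X periodic = trans (⟪⟫-[x^s-1]* h s X)
    (trans (cong (_- ⟪ h ⟫ X) (⟪⟫-ext X periodic)) (ℤ.+-inverseʳ (⟪ h ⟫ X)))

  ⟪⟫-quasiperiodic : ∀ h h₀ m s (X : Laurent k) → (∀ d → h (s ⊹ d) ≡ m * h₀ d + h d) →
                     ⟪ h ⟫ (mulL (addL (monomial s) (negL oneL)) X) ≡ m * ⟪ h₀ ⟫ X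
  ⟪⟫-quasiperiodic h h₀ m s X shift = begin
    ⟪ h ⟫ (mulL (addL (monomial s) (negL oneL)) X)   ≡⟨ ⟪⟫-[x^s-1]* h s X ⟩
    ⟪ (λ d → h (s ⊹ d)) ⟫ X - ⟪ h ⟫ X                ≡⟨ cong (_- ⟪ h ⟫ X) (⟪⟫-ext X shift) ⟩
    ⟪ (λ d → m * h₀ d + h d) ⟫ X - ⟪ h ⟫ X           ≡⟨ cong (_- ⟪ h ⟫ X) (⟪⟫-linear m h₀ h X) ⟩
    (m * ⟪ h₀ ⟫ X + ⟪ h ⟫ X) - ⟪ h ⟫ X               ≡⟨ cancel (m * ⟪ h₀ ⟫ X) (⟪ h ⟫ X) ⟩
    m * ⟪ h₀ ⟫ X                                     ∎
    where
    open ≡-Reasoning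
    cancel : ∀ x y → (x + y) - y ≡ x
    cancel = solve-∀

i≢0∧i*j≡0⇒j≡0 : ∀ {i j} → i ≢ 0ℤ → i * j ≡ 0ℤ → j ≡ 0ℤ
i≢0∧i*j≡0⇒j≡0 {i} i≢0 i*j≡0 = [ (λ i≡0 → ⊥-elim (i≢0 i≡0)) , (λ j≡0 → j≡0) ]′ (ℤ.i*j≡0⇒i≡0∨j≡0 i i*j≡0)

∣i∣<m∧m∣i⇒i≡0 : ∀ {m} i → ℤ.∣ i ∣ ℕ.< m → ℤ.+ m ∣ i → i ≡ 0ℤ
∣i∣<m∧m∣i⇒i≡0 i ∣i∣<m m∣i with ℤ.∣ i ∣ ℕ.≟ 0
... | yes ∣i∣≡0 = ℤ.∣i∣≡0⇒i≡0 ∣i∣≡0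
... | no  ∣i∣≢0 = ⊥-elim (ℕ.>⇒∤ {{ℕ.≢-nonZero ∣i∣≢0}} ∣i∣<m (∣⇒∣ᵤ m∣i))

module CongruenceClass {n : ℕ} (S : ℕ) (y : ℤ) (e : Exp n) where

  M : ℕ
  M = suc (S ℕ.+ S)

  s : Exp (suc n)
  s = ℤ.+ M ∷ 0v

  Congruent : Exp (suc n) → Set
  Congruent (x ∷ d) = d ≡ e × ℤ.+ M ∣ x - y

  congruent? : ∀ d → Dec (Congruent d)
  congruent? (x ∷ d) = d ≟v e ×-dec ℤ.+ M ∣? x - y

  χ : Exp (suc n) → ℤ
  χ d = 𝟙 (congruent? d)

  χ₁ : Exp (suc n) → ℤ
  χ₁ (x ∷ d) = χ (x ∷ d) * x

  χ-periodic : ∀ d → χ (s ⊹ d) ≡ χ d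
  χ-periodic (x ∷ d) = 𝟙-cong unshift shift (congruent? (s ⊹ (x ∷ d))) (congruent? (x ∷ d))
    where
    regroup : ℤ.+ M + x - y ≡ ℤ.+ M + (x - y)
    regroup = ℤ.+-assoc (ℤ.+ M) x (- y)
    unshift : Congruent (s ⊹ (x ∷ d)) → Congruent (x ∷ d)
    unshift (d≡e , M∣) =
      trans (sym (⊹-identityˡ d)) d≡e , ∣m+n∣m⇒∣n (subst (ℤ.+ M ∣_) regroup M∣) ∣-refl
    shift : Congruent (x ∷ d) → Congruent (s ⊹ (x ∷ d))
    shift (d≡e , M∣) =
      trans (⊹-identityˡ d) d≡e , subst (ℤ.+ M ∣_) (sym regroup) (∣m∣n⇒∣m+n ∣-refl M∣)

  χ₁-shift : ∀ d → χ₁ (s ⊹ d) ≡ ℤ.+ M * χ d + χ₁ d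
  χ₁-shift (x ∷ d) = trans (cong (_* (ℤ.+ M + x)) (χ-periodic (x ∷ d))) (expand (χ (x ∷ d)) (ℤ.+ M) x)
    where
    expand : ∀ c m x → c * (m + x) ≡ m * c + c * x
    expand = solve-∀

  χ₁-vanishes : ∀ d → χ d ≡ 0ℤ → χ₁ d ≡ 0ℤ
  χ₁-vanishes (x ∷ d) χ≡0 = trans (cong (_* x) χ≡0) (ℤ.*-zeroˡ x)

  congruent-small : ∀ {x d} → ℤ.∣ x ∣ ℕ.≤ S → ℤ.∣ y ∣ ℕ.≤ S → Congruent (x ∷ d) → x ∷ d ≡ y ∷ e
  congruent-small {x} ∣x∣≤S ∣y∣≤S (d≡e , M∣x-y) =
    cong₂ _∷_ (ℤ.i-j≡0⇒i≡j x y (∣i∣<m∧m∣i⇒i≡0 (x - y) ∣x-y∣<M M∣x-y)) d≡e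
    where
    ∣x-y∣<M : ℤ.∣ x - y ∣ ℕ.< M
    ∣x-y∣<M = ℕ.s≤s (ℕ.≤-trans (ℤ.∣i-j∣≤∣i∣+∣j∣ x y) (ℕ.+-mono-≤ ∣x∣≤S ∣y∣≤S))

module _ {n : ℕ} where

  open GeometricSeries (laurentRing (suc n)) using (GeometricResidue; ResidueWitness)

  headBound : Laurent (suc n) → ℕ
  headBound a = ℕExtrema.max 0 (map (λ d → ℤ.∣ Vec.head d ∣) (map proj₂ a))

  ∣head∣≤headBound : ∀ a {x d} → coeff a (x ∷ d) ≢ 0ℤ → ℤ.∣ x ∣ ℕ.≤ headBound a
  ∣head∣≤headBound a a≢0 =
    All.lookup (ℕExtrema.xs≤max 0 _) (∈-map⁺ (λ d → ℤ.∣ Vec.head d ∣) (∈-exponents a a≢0))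

  module NonconstantTerm (a : Laurent (suc n)) (residue : GeometricResidue a)
                         (y : ℤ) (e : Exp n) (r≢0 : y ∷ e ≢ 0v) (a≢0 : coeff a (y ∷ e) ≢ 0ℤ) where

    open CongruenceClass (headBound a) y e

    w w' : Laurent (suc n)
    w  = monomial s
    w' = monomial (negv s)

    w-1 : Laurent (suc n)
    w-1 = addL w (negL oneL)

    w*w'≋1 : mulL w w' ≋ oneL
    w*w'≋1 = mk≋ λ d → cong (λ t → coeff ((1ℤ , t) ∷ []) d) (Vec.zipWith-inverseʳ ℤ.+-inverseʳ s)

    open ResidueWitness (residue w (w' , w*w'≋1)) renaming (h to q)

    ⟪⟫-u : ∀ h → ⟪ h ⟫ u ≡ ⟪ h ⟫ (mulL w-1 g) + h 0v
    ⟪⟫-u h = trans (⟪⟫-cong h u (addL (mulL w-1 g) oneL) (coefficients u≈[w-1]*g+1))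
                   (trans (⟪⟫-++ h (mulL w-1 g) oneL) (cong (⟪ h ⟫ (mulL w-1 g) +_) (⟪⟫-oneL h)))

    ⟪⟫-g : ∀ h → ⟪ h ⟫ g ≡ ⟪ h ⟫ (mulL w-1 q) + ⟪ h ⟫ a
    ⟪⟫-g h = trans (⟪⟫-cong h g (addL (mulL w-1 q) a) (coefficients g≈[w-1]*h+a)) (⟪⟫-++ h (mulL w-1 q) a)

    ∣y∣≤S : ℤ.∣ y ∣ ℕ.≤ headBound a
    ∣y∣≤S = ∣head∣≤headBound a a≢0

    χ-on-support : ∀ d → coeff a d ≢ 0ℤ → χ d ≡ δ (y ∷ e) d
    χ-on-support (x ∷ d) ad≢0 with x ∷ d ≟v y ∷ e
    ... | yes refl = 𝟙-yes (congruent? (y ∷ e)) (refl , M∣y-y)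
      where
      M∣y-y : ℤ.+ M ∣ y - y
      M∣y-y = divides 0ℤ (trans (ℤ.+-inverseʳ y) (sym (ℤ.*-zeroˡ (ℤ.+ M))))
    ... | no d≢r =
      𝟙-no (congruent? (x ∷ d)) (λ c → d≢r (congruent-small (∣head∣≤headBound a ad≢0) ∣y∣≤S c))

    χ0≡0 : χ 0v ≡ 0ℤ
    χ0≡0 = 𝟙-no (congruent? 0v) (λ c → r≢0 (sym (congruent-small ℕ.z≤n ∣y∣≤S c)))

    T : Exp (suc n)
    T = proj₁ (unit-support-singleton u v u*v≈1)

    uT≢0 : coeff u T ≢ 0ℤ
    uT≢0 = proj₁ (proj₂ (unit-support-singleton u v u*v≈1))

    u-support : ∀ d → coeff u d ≢ 0ℤ → d ≡ T
    u-support = proj₂ (proj₂ (unit-support-singleton u v u*v≈1))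

    χT≡0 : χ T ≡ 0ℤ
    χT≡0 = i≢0∧i*j≡0⇒j≡0 uT≢0 (begin
      coeff u T * χ T                                   ≡⟨ ⟪⟫-singleton-support χ u u-support ⟨
      ⟪ χ ⟫ u                                           ≡⟨ ⟪⟫-u χ ⟩
      ⟪ χ ⟫ (mulL w-1 g) + χ 0v                         ≡⟨ cong₂ _+_ (⟪⟫-periodic χ s g χ-periodic) χ0≡0 ⟩
      0ℤ                                                ∎)
      where open ≡-Reasoning

    ⟪χ⟫g≡0 : ⟪ χ ⟫ g ≡ 0ℤ
    ⟪χ⟫g≡0 = i≢0∧i*j≡0⇒j≡0 {ℤ.+ M} (λ ()) (begin
      ℤ.+ M * ⟪ χ ⟫ g                                   ≡⟨ ⟪⟫-quasiperiodic χ₁ χ (ℤ.+ M) s g χ₁-shift ⟨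
      ⟪ χ₁ ⟫ (mulL w-1 g)                               ≡⟨ ℤ.+-identityʳ _ ⟨
      ⟪ χ₁ ⟫ (mulL w-1 g) + 0ℤ
        ≡⟨ cong (⟪ χ₁ ⟫ (mulL w-1 g) +_) (χ₁-vanishes 0v χ0≡0) ⟨
      ⟪ χ₁ ⟫ (mulL w-1 g) + χ₁ 0v                       ≡⟨ ⟪⟫-u χ₁ ⟨
      ⟪ χ₁ ⟫ u                                          ≡⟨ ⟪⟫-singleton-support χ₁ u u-support ⟩
      coeff u T * χ₁ T                                  ≡⟨ cong (coeff u T *_) (χ₁-vanishes T χT≡0) ⟩
      coeff u T * 0ℤ                                    ≡⟨ ℤ.*-zeroʳ (coeff u T) ⟩
      0ℤ                                                ∎)
      where open ≡-Reasoning

    a[r]≡0 : coeff a (y ∷ e) ≡ 0ℤ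
    a[r]≡0 = begin
      coeff a (y ∷ e)                                   ≡⟨ coeff≡⟪δ⟫ a (y ∷ e) ⟩
      ⟪ δ (y ∷ e) ⟫ a                                   ≡⟨ ⟪⟫-support χ (δ (y ∷ e)) a χ-on-support ⟨
      ⟪ χ ⟫ a                                           ≡⟨ ℤ.+-identityˡ _ ⟨
      0ℤ + ⟪ χ ⟫ a                                      ≡⟨ cong (_+ ⟪ χ ⟫ a) (⟪⟫-periodic χ s q χ-periodic) ⟨
      ⟪ χ ⟫ (mulL w-1 q) + ⟪ χ ⟫ a                      ≡⟨ ⟪⟫-g χ ⟨
      ⟪ χ ⟫ g                                           ≡⟨ ⟪χ⟫g≡0 ⟩
      0ℤ                                                ∎
      where open ≡-Reasoning

  residue⇒integer : ∀ a → GeometricResidue a → IsInteger a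
  residue⇒integer a residue = coeff a 0v , constant
    where
    constant : ∀ d → coeff a d ≡ coeff (constL (coeff a 0v)) d
    constant d with d ≟v 0v
    ... | yes refl = sym (coeff-constL-0v {suc n} (coeff a 0v))
    constant (y ∷ e) | no r≢0 = trans
      (decidable-stable (coeff a (y ∷ e) ℤ.≟ 0ℤ) λ a≢0 → a≢0 (NonconstantTerm.a[r]≡0 a residue y e r≢0 a≢0))
      (sym (coeff-constL-≢0v (coeff a 0v) r≢0))

-- Inside the quantifiers: h = var 0, g = var 1, v = var 2, u = var 3, w = var 4, a = var 5.
residueFormula : Formula
residueFormula =
  ∀f ((∃f ((var 1 ⊗ var 0) ≐ one)) ⇒f
      ∃f (∃f (∃f (∃f (((var 3 ⊗ var 2) ≐ one) ∧f
                     ((var 3 ≐ (((var 4 ⊕ (⊝ one)) ⊗ var 1) ⊕ one)) ∧f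
                      (var 1 ≐ (((var 4 ⊕ (⊝ one)) ⊗ var 0) ⊕ var 5))))))))

integerFormula : Formula
integerFormula = residueFormula ∨f ∃f ((var 0 ≐ (⊝ var 1)) ∧f residueFormula)

module _ {k : ℕ} where

  open GeometricSeries (laurentRing k)
    using (GeometricResidue; ResidueWitness; geometricResidue-resp; ×1-geometricResidue)
  open RawSemiringDefinitions (Semiring.rawSemiring (CommutativeRing.semiring (laurentRing k)))
    using () renaming (_×_ to _×ₗ_)

  sat-residueFormula⇔ : ∀ (a : Laurent k) ρ → Sat residueFormula (a ∷ₑ ρ) ⇔ GeometricResidue a
  sat-residueFormula⇔ a ρ = mk⇔ to from
    where
    to : Sat residueFormula (a ∷ₑ ρ) → GeometricResidue a
    to sat w (w' , w*w'≋1) with sat w (w' , coefficients w*w'≋1)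
    ... | u , v , g , h , u*v≈1 , u≈ , g≈ = record
      { u = u ; v = v ; g = g ; h = h
      ; u*v≈1 = mk≋ u*v≈1 ; u≈[w-1]*g+1 = mk≋ u≈ ; g≈[w-1]*h+a = mk≋ g≈ }
    from : GeometricResidue a → Sat residueFormula (a ∷ₑ ρ)
    from residue w (w' , w*w'≈1) =
      u , v , g , h , coefficients u*v≈1 , coefficients u≈[w-1]*g+1 , coefficients g≈[w-1]*h+a
      where open ResidueWitness (residue w (w' , mk≋ w*w'≈1))

  constL-0 : constL 0ℤ ≋ zeroL {k}
  constL-0 = mk≋ λ e → trans (coeff-constL 0ℤ e) (ℤ.*-zeroˡ (δ e 0v))

  constL-+ : ∀ c c' → constL (c + c') ≋ addL (constL {k} c) (constL c')
  constL-+ c c' = mk≋ λ e → begin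
    coeff (constL (c + c')) e                 ≡⟨ coeff-constL (c + c') e ⟩
    (c + c') * δ e 0v                         ≡⟨ ℤ.*-distribʳ-+ (δ e 0v) c c' ⟩
    c * δ e 0v + c' * δ e 0v                  ≡⟨ cong₂ _+_ (coeff-constL c e) (coeff-constL c' e) ⟨
    coeff (constL c) e + coeff (constL c') e  ≡⟨ coeff-++ (constL c) (constL c') e ⟨
    coeff (constL c ++ constL c') e           ∎
    where open ≡-Reasoning

  constL-ℕ : ∀ m → constL (ℤ.+ m) ≋ m ×ₗ oneL {k}
  constL-ℕ zero    = constL-0
  constL-ℕ (suc m) = ≋-trans (constL-+ 1ℤ (ℤ.+ m)) (+-cong ≋-refl (constL-ℕ m))

  constL-ℕ-residue : ∀ m {b : Laurent k} → b ≋ constL (ℤ.+ m) → GeometricResidue b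
  constL-ℕ-residue m b≋m =
    geometricResidue-resp (≋-sym (≋-trans b≋m (constL-ℕ m))) (×1-geometricResidue m)

  integer⇒sat : ∀ (a : Laurent k) ρ → IsInteger a → Sat integerFormula (a ∷ₑ ρ)
  integer⇒sat a ρ (ℤ.+ m , a≈m) =
    inj₁ (Equivalence.from (sat-residueFormula⇔ a ρ) (constL-ℕ-residue m (mk≋ a≈m)))
  integer⇒sat a ρ (ℤ.-[1+ m ] , a≈-m) =
    inj₂ (negL a , (λ _ → refl) , Equivalence.from (sat-residueFormula⇔ (negL a) (a ∷ₑ ρ))
                                    (constL-ℕ-residue (suc m) (-‿cong (mk≋ a≈-m))))

  integer-negL : ∀ (a b : Laurent k) → b ≈L negL a → IsInteger b → IsInteger a
  integer-negL a b b≈-a (c , b≈c) = - c , λ e → begin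
    coeff a e               ≡⟨ ℤ.neg-involutive (coeff a e) ⟨
    - - coeff a e           ≡⟨ cong -_ (coeff-negL a e) ⟨
    - coeff (negL a) e      ≡⟨ cong -_ (b≈-a e) ⟨
    - coeff b e             ≡⟨ cong -_ (b≈c e) ⟩
    - coeff (constL c) e    ≡⟨ coeff-negL (constL c) e ⟨
    coeff (constL (- c)) e  ∎
    where open ≡-Reasoning

sat⇒integer : ∀ {n} (a : Laurent (suc n)) ρ → Sat integerFormula (a ∷ₑ ρ) → IsInteger a
sat⇒integer a ρ (inj₁ sat) = residue⇒integer a (Equivalence.to (sat-residueFormula⇔ a ρ) sat)
sat⇒integer a ρ (inj₂ (b , b≈-a , sat)) =
  integer-negL a b b≈-a (residue⇒integer b (Equivalence.to (sat-residueFormula⇔ b (a ∷ₑ ρ)) sat))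

proposition6p5 : (n : ℕ) → Definable (suc n) IsInteger
proposition6p5 n = integerFormula , ρ , λ a → integer⇒sat a ρ , sat⇒integer a ρ
  where
  ρ : Env (suc n)
  ρ _ = zeroL
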